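{- For every rational $\epsilon\in(0,1)$, there exist undirected graphs with transition matrices $\widetilde{\mathbf{W}},\mathbf{W}$ such that $\widetilde{\mathbf{W}}\approx_\epsilon\mathbf{W}$ but $\widetilde{\mathbf{W}}^2\not\approx_c\mathbf{W}^2$ for every finite $c>0$.
   Context: The transition matrix of a graph with adjacency matrix $\mathbf{A}$ ($\mathbf{A}_{ij}$ = number of edges from $j$ to $i$; undirected edges count in both directions, multigraphs with self-loops allowed) and diagonal degree matrix $\mathbf{D}$ is $\mathbf{A}\mathbf{D}^{ -1}$. For real matrices, $\widetilde{\mathbf{W}}\approx_\epsilon\mathbf{W}$ means: for all $x,y\in\mathbb{R}^n$, $|x^\top(\mathbf{W}-\widetilde{\mathbf{W}})y|\le\frac{\epsilon}{2}(\|x\|^2+\|y\|^2-x^\top\mathbf{W}x-y^\top\mathbf{W}y)$ (for symmetric matrices this is equivalent to: for all $x\in\mathbb{R}^n$, $|x^\top(\mathbf{W}-\widetilde{\mathbf{W}})x|\le\epsilon(\|x\|^2-x^\top\mathbf{W}x)$).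
   Formalization: The test vectors x, y in the definition of $\widetilde{\mathbf{W}}\approx_\epsilon\mathbf{W}$ range over ℚ^n instead of ℝ^n, and the constant c ranges over the positive rationals. -}

module Defs where

open import Data.Nat as ℕ using (ℕ; zero; suc; NonZero)
open import Data.Fin using (Fin; zero; suc)
open import Data.Integer using (+_)
open import Data.Rational using (ℚ; 0ℚ; _+_; _*_; _-_; _/_; ½; ∣_∣; _≤_)
open import Relation.Binary.PropositionalEquality using (_≡_)

sumF : ∀ {n} → (Fin n → ℚ) → ℚ
sumF {zero}  f = 0ℚ
sumF {suc n} f = f zero + sumF (λ i → f (suc i))

sumℕ : ∀ {n} → (Fin n → ℕ) → ℕ
sumℕ {zero}  f = 0
sumℕ {suc n} f = f zero ℕ.+ sumℕ (λ i → f (suc i))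

Vec : ℕ → Set
Vec n = Fin n → ℚ

Matrix : ℕ → Set
Matrix n = Fin n → Fin n → ℚ

-- Undirected multigraph (self-loops allowed) on vertex set Fin n:
-- adj i j = number of edges between j and i (A_ij = #edges j → i, symmetric).
-- Degrees must be nonzero so that D⁻¹ exists.
degreeOf : ∀ {n} → (Fin n → Fin n → ℕ) → Fin n → ℕ
degreeOf adj j = sumℕ (λ i → adj i j)

record Graph (n : ℕ) : Set where
  field
    adj     : Fin n → Fin n → ℕ
    sym     : ∀ i j → adj i j ≡ adj j i
    deg-pos : ∀ j → NonZero (degreeOf adj j)

transition : ∀ {n} → Graph n → Matrix n
transition G i j = (+ Graph.adj G i j) / degreeOf (Graph.adj G) j
  where instance _ = Graph.deg-pos G j

_⊖_ : ∀ {n} → Matrix n → Matrix n → Matrix n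
(M ⊖ N) i j = M i j - N i j

_⊗_ : ∀ {n} → Matrix n → Matrix n → Matrix n
(M ⊗ N) i j = sumF (λ k → M i k * N k j)

bilin : ∀ {n} → Vec n → Matrix n → Vec n → ℚ
bilin x M y = sumF (λ i → sumF (λ j → x i * M i j * y j))

sqnorm : ∀ {n} → Vec n → ℚ
sqnorm x = sumF (λ i → x i * x i)

Approx : ∀ {n} → ℚ → Matrix n → Matrix n → Set
Approx ε W̃ W = ∀ x y →
  ∣ bilin x (W ⊖ W̃) y ∣ ≤ (ε * ½) * (sqnorm x + sqnorm y - bilin x W x - bilin y W y)

{-# OPTIONS --safe #-}

-- W is the walk on a single edge, which swaps the two endpoints, and W̃ the
-- lazy walk on it that stays put with probability p ≤ ε. On two vertices both
-- W − W̃ and I − W are multiples of the Laplacian of the edge, so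
-- xᵀ(W − W̃)y = −p(x₀ − x₁)(y₀ − y₁) and xᵀ(I − W)x = (x₀ − x₁)², and
-- W̃ ≈_ε W is the AM-GM inequality |uv| ≤ (u² + v²)/2. But W² = I, so the
-- right-hand side of W̃² ≈_c W² vanishes on the basis vector e₀ whatever c is,
-- which forces (W̃²)₀₀ = 1, whereas (W̃²)₀₀ = 1 − 2p(1 − p). Nothing needs ε < 1.
module Submission where

open import Defs
open import Data.Nat using (ℕ)
open import Data.Rational using (ℚ; 0ℚ; 1ℚ; _<_)
open import Data.Product using (Σ; _×_)
open import Relation.Nullary using (¬_)

open import Algebra.Properties.Group using (x∙y⁻¹≈ε⇒x≈y)
open import Data.Fin using (Fin; zero; suc)
open import Data.Fin.Patterns using (0F; 1F)
open import Data.Integer as ℤ using (+_; +[1+_])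
import Data.Integer.Properties as ℤ
import Data.Integer.Tactic.RingSolver as ℤ-Solver
open import Data.Nat as ℕ using (zero; suc; NonZero)
import Data.Nat.Properties as ℕ
open import Data.Product using (∃-syntax; _,_)
open import Data.Rational
  using (mkℚ; _+_; _*_; _-_; -_; _/_; ½; ∣_∣; _≤_; toℚᵘ; Positive; positive; nonNegative; nonPositive)
open import Data.Rational.Properties
open import Data.Rational.Unnormalised as ℚᵘ using (mkℚᵘ; *≡*; *≤*)
import Data.Rational.Unnormalised.Properties as ℚᵘ
open import Data.Sum using (inj₁; inj₂)
open import Level using (0ℓ)
open import Relation.Binary.PropositionalEquality
  using (_≡_; _≢_; refl; sym; trans; cong; cong₂; subst; subst₂; module ≡-Reasoning)
open import Relation.Nullary.Decidable using (dec⇒maybe)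
open import Tactic.RingSolver using (solve-∀)
open import Tactic.RingSolver.Core.AlmostCommutativeRing using (AlmostCommutativeRing; fromCommutativeRing)

-- Without the zero test the solver keeps cancelled coefficients and its normal forms fail to match.
ℚ-ring : AlmostCommutativeRing 0ℓ 0ℓ
ℚ-ring = fromCommutativeRing +-*-commutativeRing (λ p → dec⇒maybe (0ℚ ≟ p))

_≗₂_ : ∀ {n} → Matrix n → Matrix n → Set
M ≗₂ N = ∀ i j → M i j ≡ N i j

Symmetric : ∀ {n} → Matrix n → Set
Symmetric M = ∀ i j → M i j ≡ M j i

ColumnStochastic : ∀ {n} → Matrix n → Set
ColumnStochastic M = ∀ j → sumF (λ i → M i j) ≡ 1ℚ

Regular : ∀ {n} → ℕ → Graph n → Set
Regular d G = ∀ j → degreeOf (Graph.adj G) j ≡ d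

m/d+n/d≡[m+n]/d : ∀ m n d .{{_ : NonZero d}} → (+ m) / d + (+ n) / d ≡ (+ (m ℕ.+ n)) / d
m/d+n/d≡[m+n]/d m n (suc k) = toℚᵘ-injective (begin
  toℚᵘ ((+ m) / suc k + (+ n) / suc k)             ≈⟨ toℚᵘ-homo-+ ((+ m) / suc k) ((+ n) / suc k) ⟩
  toℚᵘ ((+ m) / suc k) ℚᵘ.+ toℚᵘ ((+ n) / suc k)    ≈⟨ ℚᵘ.+-cong (toℚᵘ-fromℚᵘ (mkℚᵘ (+ m) k))
                                                                (toℚᵘ-fromℚᵘ (mkℚᵘ (+ n) k)) ⟩
  mkℚᵘ (+ m) k ℚᵘ.+ mkℚᵘ (+ n) k                    ≈⟨ *≡* (cross-multiplied (+ m) (+ n) +[1+ k ]) ⟩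
  mkℚᵘ (+ (m ℕ.+ n)) k                             ≈⟨ toℚᵘ-fromℚᵘ (mkℚᵘ (+ (m ℕ.+ n)) k) ⟨
  toℚᵘ ((+ (m ℕ.+ n)) / suc k)                     ∎)
  where
  open ℚᵘ.≃-Reasoning
  cross-multiplied : ∀ a b d → (a ℤ.* d ℤ.+ b ℤ.* d) ℤ.* d ≡ (a ℤ.+ b) ℤ.* (d ℤ.* d)
  cross-multiplied = ℤ-Solver.solve-∀

n/n≡1 : ∀ n .{{_ : NonZero n}} → (+ n) / n ≡ 1ℚ
n/n≡1 (suc k) = toℚᵘ-injective
  (ℚᵘ.≃-trans (toℚᵘ-fromℚᵘ (mkℚᵘ (+ suc k) k)) (*≡* (ℤ.*-comm (+ suc k) (+ 1))))

0≤p*p : ∀ p → 0ℚ ≤ p * p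
0≤p*p p with ≤-total 0ℚ p
... | inj₁ 0≤p = nonNegative⁻¹ (p * p) {{nonNeg*nonNeg⇒nonNeg p {{nonNegative 0≤p}} p {{nonNegative 0≤p}}}}
... | inj₂ p≤0 = nonNegative⁻¹ (p * p) {{nonPos*nonPos⇒nonPos p {{nonPositive p≤0}} p {{nonPositive p≤0}}}}

p≤p+½q*q : ∀ p q → p ≤ p + ½ * (q * q)
p≤p+½q*q p q = subst (_≤ p + ½ * (q * q)) (+-identityʳ p)
  (+-monoʳ-≤ p (nonNegative⁻¹ (½ * (q * q)) {{nonNeg*nonNeg⇒nonNeg ½ (q * q) {{nonNegative (0≤p*p q)}}}}))

∣p*q∣≤½[p*p+q*q] : ∀ p q → ∣ p * q ∣ ≤ ½ * (p * p + q * q)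
∣p*q∣≤½[p*p+q*q] p q with ∣p∣≡p∨∣p∣≡-p (p * q)
... | inj₁ ∣pq∣≡pq  = subst₂ _≤_ (sym ∣pq∣≡pq) (gap₋ p q) (p≤p+½q*q (p * q) (p - q))
  where
  gap₋ : ∀ p q → p * q + ½ * ((p - q) * (p - q)) ≡ ½ * (p * p + q * q)
  gap₋ = solve-∀ ℚ-ring
... | inj₂ ∣pq∣≡-pq = subst₂ _≤_ (sym ∣pq∣≡-pq) (gap₊ p q) (p≤p+½q*q (- (p * q)) (p + q))
  where
  gap₊ : ∀ p q → - (p * q) + ½ * ((p + q) * (p + q)) ≡ ½ * (p * p + q * q)
  gap₊ = solve-∀ ℚ-ring

1/[2+m]≤-archimedean : ∀ {ε} → 0ℚ < ε → ∃[ m ] (+ 1) / suc (suc m) ≤ ε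
1/[2+m]≤-archimedean {ε} 0<ε = go ε (positive 0<ε)
  where
  go : ∀ ε → Positive ε → ∃[ m ] (+ 1) / suc (suc m) ≤ ε
  -- For ε = (n + 1)/d take 1/(d + 1), cross-multiplied: d ≤ (n + 1)(d + 1).
  go (mkℚ +[1+ n ] d-1 _) _ = d-1 , toℚᵘ-cancel-≤
    (ℚᵘ.≤-respˡ-≃ (ℚᵘ.≃-sym (toℚᵘ-fromℚᵘ (mkℚᵘ (+ 1) (suc d-1))))
      (*≤* (ℤ.+≤+ (ℕ.s≤s (ℕ.m≤n⇒m≤1+n (ℕ.+-monoʳ-≤ d-1 ℕ.z≤n))))))

sumF-cong : ∀ {n} {f g : Fin n → ℚ} → (∀ i → f i ≡ g i) → sumF f ≡ sumF g
sumF-cong {zero}  f≗g = refl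
sumF-cong {suc n} f≗g = cong₂ _+_ (f≗g zero) (sumF-cong (λ i → f≗g (suc i)))

sumF-0 : ∀ {n} → sumF {n} (λ _ → 0ℚ) ≡ 0ℚ
sumF-0 {zero}  = refl
sumF-0 {suc n} = trans (+-identityˡ (sumF {n} (λ _ → 0ℚ))) (sumF-0 {n})

sumF-/ : ∀ {n} (a : Fin n → ℕ) d .{{_ : NonZero d}} → sumF (λ i → (+ a i) / d) ≡ (+ sumℕ a) / d
sumF-/ {zero}  a d = sym (0/n≡0 d)
sumF-/ {suc n} a d =
  trans (cong (_+_ ((+ a zero) / d)) (sumF-/ (λ i → a (suc i)) d))
        (m/d+n/d≡[m+n]/d (a zero) (sumℕ (λ i → a (suc i))) d)

sumF-Fin2 : (f : Fin 2 → ℚ) → sumF f ≡ f 0F + f 1F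
sumF-Fin2 f = cong (_+_ (f 0F)) (+-identityʳ (f 1F))

bilin-cong : ∀ {n} (x y : Vec n) {M N : Matrix n} → M ≗₂ N → bilin x M y ≡ bilin x N y
bilin-cong x y M≗N = sumF-cong λ i → sumF-cong λ j → cong (λ m → x i * m * y j) (M≗N i j)

bilin-Fin2 : ∀ (x : Vec 2) M y →
  bilin x M y ≡ x 0F * M 0F 0F * y 0F + x 0F * M 0F 1F * y 1F + (x 1F * M 1F 0F * y 0F + x 1F * M 1F 1F * y 1F)
bilin-Fin2 x M y = trans (sumF-Fin2 (λ i → sumF (λ j → x i * M i j * y j)))
  (cong₂ _+_ (sumF-Fin2 (λ j → x 0F * M 0F j * y j)) (sumF-Fin2 (λ j → x 1F * M 1F j * y j)))

⊗-cong : ∀ {n} {M M′ N N′ : Matrix n} → M ≗₂ M′ → N ≗₂ N′ → (M ⊗ N) ≗₂ (M′ ⊗ N′)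
⊗-cong M≗M′ N≗N′ i j = sumF-cong λ k → cong₂ _*_ (M≗M′ i k) (N≗N′ k j)

basis : ∀ {n} → Fin n → Vec n
basis zero    zero    = 1ℚ
basis zero    (suc _) = 0ℚ
basis (suc i) zero    = 0ℚ
basis (suc i) (suc j) = basis i j

basis-diagonal : ∀ {n} (i : Fin n) → basis i i ≡ 1ℚ
basis-diagonal zero    = refl
basis-diagonal (suc i) = basis-diagonal i

sumF-basisˡ : ∀ {n} (i : Fin n) (f : Fin n → ℚ) → sumF (λ j → basis i j * f j) ≡ f i
sumF-basisˡ {suc n} zero f = begin
  1ℚ * f zero + sumF (λ j → 0ℚ * f (suc j)) ≡⟨ cong₂ _+_ (*-identityˡ (f zero))
                                                          (sumF-cong {n} λ j → *-zeroˡ (f (suc j))) ⟩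
  f zero + sumF {n} (λ _ → 0ℚ)              ≡⟨ cong (_+_ (f zero)) (sumF-0 {n}) ⟩
  f zero + 0ℚ                               ≡⟨ +-identityʳ (f zero) ⟩
  f zero                                    ∎
  where open ≡-Reasoning
sumF-basisˡ (suc i) f =
  trans (cong₂ _+_ (*-zeroˡ (f zero)) (sumF-basisˡ i (λ j → f (suc j)))) (+-identityˡ (f (suc i)))

sumF-basisʳ : ∀ {n} (i : Fin n) (f : Fin n → ℚ) → sumF (λ j → f j * basis i j) ≡ f i
sumF-basisʳ i f = trans (sumF-cong λ j → *-comm (f j) (basis i j)) (sumF-basisˡ i f)

bilin-basis : ∀ {n} (M : Matrix n) i j → bilin (basis i) M (basis j) ≡ M i j
bilin-basis M i j =
  trans (sumF-cong λ k → sumF-basisʳ j (λ l → basis i k * M k l)) (sumF-basisˡ i (λ k → M k j))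

sqnorm-basis : ∀ {n} (i : Fin n) → sqnorm (basis i) ≡ 1ℚ
sqnorm-basis i = trans (sumF-basisˡ i (basis i)) (basis-diagonal i)

Approx-cong : ∀ {n ε} {W̃ W̃′ W W′ : Matrix n} →
  W̃ ≗₂ W̃′ → W ≗₂ W′ → Approx ε W̃′ W′ → Approx ε W̃ W
Approx-cong {ε = ε} W̃≗ W≗ approx x y = subst₂ _≤_
  (cong ∣_∣ (bilin-cong x y λ i j → cong₂ _-_ (sym (W≗ i j)) (sym (W̃≗ i j))))
  (cong₂ (λ a b → ε * ½ * (sqnorm x + sqnorm y - a - b))
    (bilin-cong x x λ i j → sym (W≗ i j)) (bilin-cong y y λ i j → sym (W≗ i j)))
  (approx x y)

Approx-diagonal : ∀ {n c} {W̃ W : Matrix n} → Approx c W̃ W → ∀ i →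
  ∣ W i i - W̃ i i ∣ ≤ c * ½ * (1ℚ + 1ℚ - W i i - W i i)
Approx-diagonal {c = c} {W̃} {W} approx i = subst₂ _≤_
  (cong ∣_∣ (bilin-basis (W ⊖ W̃) i i))
  (cong₂ (λ s w → c * ½ * (s + s - w - w)) (sqnorm-basis i) (bilin-basis W i i))
  (approx (basis i) (basis i))

-- Where W has a 1 on the diagonal, the right-hand side of the approximation
-- vanishes on the corresponding basis vector, whatever the (even negative) c.
Approx-unit-diagonal : ∀ {n c} {W̃ W : Matrix n} → Approx c W̃ W → ∀ i → W i i ≡ 1ℚ → W̃ i i ≡ 1ℚ
Approx-unit-diagonal {c = c} {W̃} {W} approx i Wᵢᵢ≡1 =
  sym (x∙y⁻¹≈ε⇒x≈y +-0-group 1ℚ (W̃ i i)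
    (∣p∣≡0⇒p≡0 (1ℚ - W̃ i i) (≤-antisym bound (0≤∣p∣ (1ℚ - W̃ i i)))))
  where
  bound : ∣ 1ℚ - W̃ i i ∣ ≤ 0ℚ
  bound = subst₂ _≤_
    (cong (λ w → ∣ w - W̃ i i ∣) Wᵢᵢ≡1)
    (trans (cong (λ w → c * ½ * (1ℚ + 1ℚ - w - w)) Wᵢᵢ≡1) (*-zeroʳ (c * ½)))
    (Approx-diagonal {c = c} {W̃} {W} approx i)

transition-columnStochastic : ∀ {n} (G : Graph n) → ColumnStochastic (transition G)
transition-columnStochastic G j =
  trans (sumF-/ (λ i → adj i j) (degreeOf adj j) {{deg-pos j}}) (n/n≡1 (degreeOf adj j) {{deg-pos j}})
  where open Graph G

transition-symmetric : ∀ {n d} (G : Graph n) → Regular d G → Symmetric (transition G)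
transition-symmetric G regular i j = /-cong {{Graph.deg-pos G j}} {{Graph.deg-pos G i}}
  (cong +_ (Graph.sym G i j)) (trans (regular j) (sym (regular i)))

transition-pos : ∀ {n} (G : Graph n) i j .{{_ : NonZero (Graph.adj G i j)}} → 0ℚ < transition G i j
transition-pos G i j =
  positive⁻¹ _ {{normalize-pos (Graph.adj G i j) (degreeOf (Graph.adj G) j) {{Graph.deg-pos G j}}}}

lazySwap : ℚ → Matrix 2
lazySwap p 0F 0F = p
lazySwap p 0F 1F = 1ℚ - p
lazySwap p 1F 0F = 1ℚ - p
lazySwap p 1F 1F = p

swap : Matrix 2
swap = lazySwap 0ℚ

symmetric∧stochastic⇒lazySwap : ∀ M → Symmetric M → ColumnStochastic M → M ≗₂ lazySwap (M 0F 0F)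
symmetric∧stochastic⇒lazySwap M symmetric stochastic = entries
  where
  complement : ∀ j → M 1F j ≡ 1ℚ - M 0F j
  complement j = begin
    M 1F j                   ≡⟨ cancel (M 0F j) (M 1F j) ⟨
    M 0F j + M 1F j - M 0F j ≡⟨ cong (_- M 0F j) (trans (sym (sumF-Fin2 (λ i → M i j))) (stochastic j)) ⟩
    1ℚ - M 0F j              ∎
    where
    open ≡-Reasoning
    cancel : ∀ p q → p + q - p ≡ q
    cancel = solve-∀ ℚ-ring
  off-diagonal : M 0F 1F ≡ 1ℚ - M 0F 0F
  off-diagonal = trans (symmetric 0F 1F) (complement 0F)
  entries : M ≗₂ lazySwap (M 0F 0F)
  entries 0F 0F = refl
  entries 1F 0F = complement 0F
  entries 0F 1F = off-diagonal
  entries 1F 1F = trans (complement 1F) (trans (cong (_-_ 1ℚ) off-diagonal) (involutive (M 0F 0F)))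
    where
    involutive : ∀ p → 1ℚ - (1ℚ - p) ≡ p
    involutive = solve-∀ ℚ-ring

bilin-swap⊖lazySwap : ∀ p x y → bilin x (swap ⊖ lazySwap p) y ≡ - (p * ((x 0F - x 1F) * (y 0F - y 1F)))
bilin-swap⊖lazySwap p x y = trans (bilin-Fin2 x (swap ⊖ lazySwap p) y) (expand p (x 0F) (x 1F) (y 0F) (y 1F))
  where
  expand : ∀ p x₀ x₁ y₀ y₁ →
    x₀ * (0ℚ - p) * y₀ + x₀ * (1ℚ - (1ℚ - p)) * y₁
      + (x₁ * (1ℚ - (1ℚ - p)) * y₀ + x₁ * (0ℚ - p) * y₁)
      ≡ - (p * ((x₀ - x₁) * (y₀ - y₁)))
  expand = solve-∀ ℚ-ring

sqnorm-bilin-swap : ∀ x → sqnorm x - bilin x swap x ≡ (x 0F - x 1F) * (x 0F - x 1F)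
sqnorm-bilin-swap x = trans (cong₂ _-_ (sumF-Fin2 (λ i → x i * x i)) (bilin-Fin2 x swap x)) (expand (x 0F) (x 1F))
  where
  expand : ∀ x₀ x₁ →
    x₀ * x₀ + x₁ * x₁ - (x₀ * 0ℚ * x₀ + x₀ * 1ℚ * x₁ + (x₁ * 1ℚ * x₀ + x₁ * 0ℚ * x₁))
      ≡ (x₀ - x₁) * (x₀ - x₁)
  expand = solve-∀ ℚ-ring

lazySwap-approx-swap : ∀ {ε p} → 0ℚ ≤ p → p ≤ ε → Approx ε (lazySwap p) swap
lazySwap-approx-swap {ε} {p} 0≤p p≤ε x y = begin
  ∣ bilin x (swap ⊖ lazySwap p) y ∣ ≡⟨ cong ∣_∣ (bilin-swap⊖lazySwap p x y) ⟩
  ∣ - (p * (u * v)) ∣               ≡⟨ ∣-p∣≡∣p∣ (p * (u * v)) ⟩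
  ∣ p * (u * v) ∣                   ≡⟨ ∣p*q∣≡∣p∣*∣q∣ p (u * v) ⟩
  ∣ p ∣ * ∣ u * v ∣                 ≡⟨ cong (_* ∣ u * v ∣) (0≤p⇒∣p∣≡p 0≤p) ⟩
  p * ∣ u * v ∣                     ≤⟨ *-monoʳ-≤-nonNeg ∣ u * v ∣ {{∣-∣-nonNeg (u * v)}} p≤ε ⟩
  ε * ∣ u * v ∣                     ≤⟨ *-monoˡ-≤-nonNeg ε {{nonNegative (≤-trans 0≤p p≤ε)}}
                                                         (∣p*q∣≤½[p*p+q*q] u v) ⟩
  ε * (½ * (u * u + v * v))         ≡⟨ sym (*-assoc ε ½ (u * u + v * v)) ⟩
  ε * ½ * (u * u + v * v)           ≡⟨ cong (ε * ½ *_) (sym energies) ⟩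
  ε * ½ * (sqnorm x + sqnorm y - bilin x swap x - bilin y swap y) ∎
  where
  open ≤-Reasoning
  u = x 0F - x 1F
  v = y 0F - y 1F
  regroup : ∀ a b c d → a + b - c - d ≡ (a - c) + (b - d)
  regroup = solve-∀ ℚ-ring
  energies : sqnorm x + sqnorm y - bilin x swap x - bilin y swap y ≡ u * u + v * v
  energies = trans (regroup (sqnorm x) (sqnorm y) (bilin x swap x) (bilin y swap y))
    (cong₂ _+_ (sqnorm-bilin-swap x) (sqnorm-bilin-swap y))

lazySwap²-diagonal≢1 : ∀ {p} → 0ℚ < p → 0ℚ < 1ℚ - p → (lazySwap p ⊗ lazySwap p) 0F 0F ≢ 1ℚ
lazySwap²-diagonal≢1 {p} 0<p 0<1-p L²₀₀≡1 = <-irrefl refl (begin-strict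
  0ℚ                                   <⟨ positive⁻¹ (w + w) {{pos+pos⇒pos w w}} ⟩
  w + w                                ≡⟨ sym (defect p) ⟩
  1ℚ - (lazySwap p ⊗ lazySwap p) 0F 0F ≡⟨ cong (_-_ 1ℚ) L²₀₀≡1 ⟩
  1ℚ - 1ℚ                              ≡⟨ +-inverseʳ 1ℚ ⟩
  0ℚ                                   ∎)
  where
  open ≤-Reasoning
  w = p * (1ℚ - p)
  instance
    w-pos : Positive w
    w-pos = pos*pos⇒pos p {{positive 0<p}} (1ℚ - p) {{positive 0<1-p}}
  defect : ∀ p → 1ℚ - (p * p + ((1ℚ - p) * (1ℚ - p) + 0ℚ)) ≡ p * (1ℚ - p) + p * (1ℚ - p)
  defect = solve-∀ ℚ-ring

loopedEdge : (loops edges : ℕ) .{{_ : NonZero edges}} → Graph 2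
loopedEdge ℓ e@(suc _) = record { adj = adj ; sym = symmetric ; deg-pos = degree-nonZero }
  where
  adj : Fin 2 → Fin 2 → ℕ
  adj 0F 0F = ℓ
  adj 0F 1F = e
  adj 1F 0F = e
  adj 1F 1F = ℓ
  symmetric : ∀ i j → adj i j ≡ adj j i
  symmetric 0F 0F = refl
  symmetric 0F 1F = refl
  symmetric 1F 0F = refl
  symmetric 1F 1F = refl
  degree-nonZero : ∀ j → NonZero (degreeOf adj j)
  degree-nonZero 0F = ℕ.>-nonZero (ℕ.<-≤-trans (ℕ.s≤s ℕ.z≤n) (ℕ.m≤n+m (e ℕ.+ 0) ℓ))
  degree-nonZero 1F = _

loopedEdge-regular : ∀ ℓ e .{{_ : NonZero e}} → Regular (ℓ ℕ.+ e) (loopedEdge ℓ e)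
loopedEdge-regular ℓ e@(suc _) 0F = cong (ℓ ℕ.+_) (ℕ.+-identityʳ e)
loopedEdge-regular ℓ e@(suc _) 1F = trans (cong (e ℕ.+_) (ℕ.+-identityʳ ℓ)) (ℕ.+-comm e ℓ)

transition-loopedEdge : ∀ ℓ e .{{_ : NonZero e}} →
  transition (loopedEdge ℓ e) ≗₂ lazySwap (transition (loopedEdge ℓ e) 0F 0F)
transition-loopedEdge ℓ e = symmetric∧stochastic⇒lazySwap (transition (loopedEdge ℓ e))
  (transition-symmetric (loopedEdge ℓ e) (loopedEdge-regular ℓ e))
  (transition-columnStochastic (loopedEdge ℓ e))

proposition4p1 : (ε : ℚ) → 0ℚ < ε → ε < 1ℚ →
    Σ ℕ (λ n → Σ (Graph n) (λ G̃ → Σ (Graph n) (λ G →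
      Approx ε (transition G̃) (transition G)
      × ((c : ℚ) → 0ℚ < c →
          ¬ Approx c (transition G̃ ⊗ transition G̃) (transition G ⊗ transition G)))))
proposition4p1 ε 0<ε _ with 1/[2+m]≤-archimedean 0<ε
... | m , 1/[2+m]≤ε = 2 , G̃ , G , W̃≈W , W̃²≉W²
  where
  G̃ = loopedEdge 1 (suc m)
  G = loopedEdge 0 1
  p = transition G̃ 0F 0F
  W̃≗ : transition G̃ ≗₂ lazySwap p
  W̃≗ = transition-loopedEdge 1 (suc m)
  W≗ : transition G ≗₂ swap
  W≗ = transition-loopedEdge 0 1
  W̃² W² : Matrix 2
  W̃² = transition G̃ ⊗ transition G̃
  W² = transition G ⊗ transition G
  W²₀₀≡1 : W² 0F 0F ≡ 1ℚ
  W²₀₀≡1 = refl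
  0<p : 0ℚ < p
  0<p = transition-pos G̃ 0F 0F
  0<1-p : 0ℚ < 1ℚ - p
  0<1-p = subst (0ℚ <_) (W̃≗ 1F 0F) (transition-pos G̃ 1F 0F)
  p≤ε : p ≤ ε
  p≤ε = subst (_≤ ε) (/-cong {+ 1} refl (cong (λ k → suc (suc k)) (sym (ℕ.+-identityʳ m)))) 1/[2+m]≤ε
  W̃≈W : Approx ε (transition G̃) (transition G)
  W̃≈W = Approx-cong {ε = ε} W̃≗ W≗ (lazySwap-approx-swap (<⇒≤ 0<p) p≤ε)
  W̃²≉W² : (c : ℚ) → 0ℚ < c → ¬ Approx c W̃² W²
  W̃²≉W² c _ approx = lazySwap²-diagonal≢1 0<p 0<1-p
    (trans (sym (⊗-cong W̃≗ W̃≗ 0F 0F)) (Approx-unit-diagonal {c = c} {W̃²} {W²} approx 0F W²₀₀≡1))
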